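{- Let $\Pi\subseteq S_3$ with $\Pi\neq S_3$, and suppose $\Pi$ intersects each of $M_1$, $M_2$ and $M_3$. Then $p_\Pi(n)=2$ for every $n\ge3$.
   Context: Elements of $S_3$ are written as words $abc$. Let $M_1=\{213,312\}$, $M_2=\{123,321\}$ and $M_3=\{132,231\}$. An ordering of $[n]$ is a bijection $\phi:[n]\to[n]$. A ternary constraint is a triple $\mathbf x=(x_1,x_2,x_3)$ of distinct elements of $[n]$. $\mathrm{ord}(\phi,\mathbf x)$ is the word $abc$ with $\phi(x_a)<\phi(x_b)<\phi(x_c)$. For nonempty $\Pi$, $p_\Pi(n)$ is the minimum size of a set $\Phi$ of orderings of $[n]$ such that every constraint $\mathbf x$ has some $\phi\in\Phi$ with $\mathrm{ord}(\phi,\mathbf x)\in\Pi$. -}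

module Defs where

open import Data.Nat using (ℕ; _≤_)
open import Data.Fin using (Fin; zero; suc) renaming (_<_ to _<ᶠ_)
open import Data.Bool using (Bool; true; false)
open import Data.List using (List; length)
open import Data.List.Relation.Unary.Any using (Any)
open import Data.Sum using (_⊎_)
open import Data.Product using (Σ; _×_; _,_; ∃)
open import Relation.Binary.PropositionalEquality using (_≡_; _≢_)
open import Function.Bundles using (_⤖_; Bijection)

data S₃ : Set where
  s123 s132 s213 s231 s312 s321 : S₃

-- The letters of a word abc (as indices 1,2,3 ↦ Fin 3: 0,1,2).
letter₁ letter₂ letter₃ : S₃ → Fin 3
letter₁ s123 = zero
letter₁ s132 = zero
letter₁ s213 = suc zero
letter₁ s231 = suc zero
letter₁ s312 = suc (suc zero)
letter₁ s321 = suc (suc zero)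
letter₂ s123 = suc zero
letter₂ s132 = suc (suc zero)
letter₂ s213 = zero
letter₂ s231 = suc (suc zero)
letter₂ s312 = zero
letter₂ s321 = suc zero
letter₃ s123 = suc (suc zero)
letter₃ s132 = suc zero
letter₃ s213 = suc (suc zero)
letter₃ s231 = zero
letter₃ s312 = suc zero
letter₃ s321 = zero

SubS₃ : Set
SubS₃ = S₃ → Bool

_∈Π_ : S₃ → SubS₃ → Set
w ∈Π Π = Π w ≡ true

IsProper : SubS₃ → Set
IsProper Π = Σ S₃ λ w → Π w ≡ false

M₁ M₂ M₃ : S₃ → Set
M₁ w = (w ≡ s213) ⊎ (w ≡ s312)
M₂ w = (w ≡ s123) ⊎ (w ≡ s321)
M₃ w = (w ≡ s132) ⊎ (w ≡ s231)

Meets : SubS₃ → (S₃ → Set) → Set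
Meets Π M = Σ S₃ λ w → (w ∈Π Π) × M w

Ordering : ℕ → Set
Ordering n = Fin n ⤖ Fin n

record Constraint (n : ℕ) : Set where
  constructor ⟨_,_,_⟩
  field
    x₁ x₂ x₃ : Fin n
    d₁₂ : x₁ ≢ x₂
    d₁₃ : x₁ ≢ x₃
    d₂₃ : x₂ ≢ x₃

component : ∀ {n} → Constraint n → Fin 3 → Fin n
component c zero = Constraint.x₁ c
component c (suc zero) = Constraint.x₂ c
component c (suc (suc zero)) = Constraint.x₃ c

-- ord(φ, x) ≡ w, i.e. φ(x_a) < φ(x_b) < φ(x_c) for w = abc.
OrdIs : ∀ {n} → Ordering n → Constraint n → S₃ → Set
OrdIs φ c w =
  (f (component c (letter₁ w)) <ᶠ f (component c (letter₂ w))) ×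
  (f (component c (letter₂ w)) <ᶠ f (component c (letter₃ w)))
  where f = Bijection.to φ

OrdIn : ∀ {n} → SubS₃ → Ordering n → Constraint n → Set
OrdIn Π φ c = Σ S₃ λ w → (w ∈Π Π) × OrdIs φ c w

Covers : ∀ {n} → SubS₃ → List (Ordering n) → Set
Covers {n} Π Φ = (c : Constraint n) → Any (λ φ → OrdIn Π φ c) Φ

-- p_Π(n) = k : some family of k orderings covers, and every covering
-- family has at least k members.  (Lists may repeat entries; this only
-- increases length, so the minimum over lists equals the minimum over sets.)
pIs : SubS₃ → ℕ → ℕ → Set
pIs Π n k =
  (Σ (List (Ordering n)) λ Φ → (length Φ ≡ k) × Covers Π Φ) ×
  ((Φ : List (Ordering n)) → Covers Π Φ → k ≤ length Φ)

module Submission where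

-- For an ordering φ and a constraint x, write v = φ ∘ x for the
-- three values of φ on x; the pattern ord(φ, x) is the word w with v "sorted
-- by w" (Sorted v w).  The whole argument rests on three facts about Sorted:
--   * existence and uniqueness: three distinct values are sorted by exactly
--     one word (uniqueness goes through the comparison signature of a word);
--   * reversal: an order-reversing map turns a pattern w into its reverse;
--   * realisation: for n ≥ 3 and every φ, every word w is ord(φ, x) for some x.
-- Upper bound: M₁, M₂, M₃ are exactly the pairs {w, reverse w}, so Π contains
-- w or its reverse for every w; hence any φ together with its reverse
-- (opposite ∘ φ) covers every constraint.
-- Lower bound: pick w ∉ Π; a single ordering φ realises w on some x and, by
-- uniqueness, no word of Π there, so one ordering never suffices.

open import Defs
open import Data.Nat using (ℕ; suc; _+_; _≤_; z≤n; s≤s; z<s; s<s)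
import Data.Nat as ℕ
open import Data.Nat.Properties using (∸-monoʳ-<)
open import Data.Fin using (Fin; zero; suc; toℕ; opposite; #_) renaming (_<_ to _<ᶠ_)
open import Data.Fin.Properties
  using (<-cmp; <-asym; <-trans; opposite-prop; opposite-involutive; toℕ<n)
open import Data.Bool using (Bool; true; false)
open import Data.List using (List; length; []; _∷_)
open import Data.List.Relation.Unary.Any using (here; there)
open import Data.Sum using (_⊎_; inj₁; inj₂; swap)
open import Data.Product using (Σ; _×_; _,_; proj₁; proj₂)
open import Data.Empty using (⊥-elim)
open import Function using (_∘_)
open import Function.Bundles using (Bijection; mk↔ₛ′)
open import Function.Construct.Identity using (⤖-id)
open import Function.Construct.Composition using (_⤖-∘_)
open import Function.Properties.Inverse using (↔⇒⤖)
open import Relation.Binary using (tri<; tri≈; tri>)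
open import Relation.Binary.PropositionalEquality
  using (_≡_; _≢_; refl; sym; trans; cong; cong₂; subst₂)
open import Relation.Nullary using (¬_)

private
  variable
    n : ℕ

Sorted : (Fin 3 → Fin n) → S₃ → Set
Sorted v w = v (letter₁ w) <ᶠ v (letter₂ w) × v (letter₂ w) <ᶠ v (letter₃ w)

sorted-exists : (v : Fin 3 → Fin n) →
  v zero ≢ v (suc zero) → v zero ≢ v (suc (suc zero)) → v (suc zero) ≢ v (suc (suc zero)) →
  Σ S₃ (Sorted v)
sorted-exists v d₁₂ d₁₃ d₂₃ with <-cmp (v zero) (v (suc zero))
... | tri≈ _ e _ = ⊥-elim (d₁₂ e)
... | tri< p _ _ with <-cmp (v (suc zero)) (v (suc (suc zero)))
...   | tri< q _ _ = s123 , p , q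
...   | tri≈ _ e _ = ⊥-elim (d₂₃ e)
...   | tri> _ _ q with <-cmp (v zero) (v (suc (suc zero)))
...     | tri< r _ _ = s132 , r , q
...     | tri≈ _ e _ = ⊥-elim (d₁₃ e)
...     | tri> _ _ r = s312 , r , p
sorted-exists v d₁₂ d₁₃ d₂₃ | tri> _ _ p with <-cmp (v zero) (v (suc (suc zero)))
...   | tri< q _ _ = s213 , p , q
...   | tri≈ _ e _ = ⊥-elim (d₁₃ e)
...   | tri> _ _ q with <-cmp (v (suc zero)) (v (suc (suc zero)))
...     | tri< r _ _ = s231 , r , q
...     | tri≈ _ e _ = ⊥-elim (d₂₃ e)
...     | tri> _ _ r = s321 , r , p

Compared : Fin n → Fin n → Bool → Set
Compared x y true  = x <ᶠ y
Compared x y false = y <ᶠ x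

compared-unique : ∀ {x y : Fin n} {b b′} → Compared x y b → Compared x y b′ → b ≡ b′
compared-unique {b = true}  {true}  _ _ = refl
compared-unique {b = true}  {false} p q = ⊥-elim (<-asym p q)
compared-unique {b = false} {true}  p q = ⊥-elim (<-asym p q)
compared-unique {b = false} {false} _ _ = refl

Signature : Set
Signature = Bool × Bool × Bool

-- The signature of a word records whether 1 precedes 2, 1 precedes 3 and
-- 2 precedes 3 in it.
signature : S₃ → Signature
signature s123 = true  , true  , true
signature s132 = true  , true  , false
signature s213 = false , true  , true
signature s231 = false , false , true
signature s312 = true  , false , false
signature s321 = false , false , false

-- A left inverse of signature; the two cyclic signatures occur for no word.
fromSignature : Signature → S₃
fromSignature (true  , true  , false) = s132
fromSignature (false , true  , true ) = s213
fromSignature (false , false , true ) = s231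
fromSignature (true  , false , false) = s312
fromSignature (false , false , false) = s321
fromSignature _                       = s123

fromSignature-signature : ∀ w → fromSignature (signature w) ≡ w
fromSignature-signature s123 = refl
fromSignature-signature s132 = refl
fromSignature-signature s213 = refl
fromSignature-signature s231 = refl
fromSignature-signature s312 = refl
fromSignature-signature s321 = refl

signature-injective : ∀ {w w′} → signature w ≡ signature w′ → w ≡ w′
signature-injective {w} {w′} e =
  trans (sym (fromSignature-signature w))
        (trans (cong fromSignature e) (fromSignature-signature w′))

HasSignature : (Fin 3 → Fin n) → Signature → Set
HasSignature v (b₁₂ , b₁₃ , b₂₃) =
  Compared (v zero) (v (suc zero)) b₁₂ ×
  Compared (v zero) (v (suc (suc zero))) b₁₃ ×
  Compared (v (suc zero)) (v (suc (suc zero))) b₂₃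

sorted⇒signature : ∀ (v : Fin 3 → Fin n) w → Sorted v w → HasSignature v (signature w)
sorted⇒signature _ s123 (p , q) = p , <-trans p q , q
sorted⇒signature _ s132 (p , q) = <-trans p q , p , q
sorted⇒signature _ s213 (p , q) = p , q , <-trans p q
sorted⇒signature _ s231 (p , q) = <-trans p q , q , p
sorted⇒signature _ s312 (p , q) = q , p , <-trans p q
sorted⇒signature _ s321 (p , q) = q , <-trans p q , p

signature-unique : ∀ (v : Fin 3 → Fin n) s s′ → HasSignature v s → HasSignature v s′ → s ≡ s′
signature-unique _ _ _ (p₁ , p₂ , p₃) (q₁ , q₂ , q₃) =
  cong₂ _,_ (compared-unique p₁ q₁) (cong₂ _,_ (compared-unique p₂ q₂) (compared-unique p₃ q₃))

sorted-unique : ∀ (v : Fin 3 → Fin n) {w w′} → Sorted v w → Sorted v w′ → w ≡ w′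
sorted-unique v {w} {w′} o o′ =
  signature-injective
    (signature-unique v (signature w) (signature w′) (sorted⇒signature v w o) (sorted⇒signature v w′ o′))

reverse : S₃ → S₃
reverse s123 = s321
reverse s132 = s231
reverse s213 = s312
reverse s231 = s132
reverse s312 = s213
reverse s321 = s123

sorted-reverse : ∀ {m} (v : Fin 3 → Fin n) (g : Fin n → Fin m) →
  (∀ {x y} → x <ᶠ y → g y <ᶠ g x) → ∀ w → Sorted v w → Sorted (g ∘ v) (reverse w)
sorted-reverse _ g anti s123 (p , q) = anti q , anti p
sorted-reverse _ g anti s132 (p , q) = anti q , anti p
sorted-reverse _ g anti s213 (p , q) = anti q , anti p
sorted-reverse _ g anti s231 (p , q) = anti q , anti p
sorted-reverse _ g anti s312 (p , q) = anti q , anti p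
sorted-reverse _ g anti s321 (p , q) = anti q , anti p

opposite-reverses : {x y : Fin n} → x <ᶠ y → opposite y <ᶠ opposite x
opposite-reverses {n} {x} {y} x<y =
  subst₂ ℕ._<_ (sym (opposite-prop y)) (sym (opposite-prop x))
    (∸-monoʳ-< {n} {suc (toℕ y)} {suc (toℕ x)} (s<s x<y) (toℕ<n y))

reversed : Ordering n → Ordering n
reversed φ = ↔⇒⤖ (mk↔ₛ′ opposite opposite opposite-involutive opposite-involutive) ⤖-∘ φ

pattern-exists : (φ : Ordering n) (x : Constraint n) → Σ S₃ (OrdIs φ x)
pattern-exists φ x@(⟨ _ , _ , _ ⟩ d₁₂ d₁₃ d₂₃) =
  sorted-exists (Bijection.to φ ∘ component x)
    (d₁₂ ∘ Bijection.injective φ) (d₁₃ ∘ Bijection.injective φ) (d₂₃ ∘ Bijection.injective φ)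

-- Each M_i is a pair {w, reverse w}, so Π meets every such pair.
meets-every-reversal-pair : ∀ {Π} → Meets Π M₁ → Meets Π M₂ → Meets Π M₃ →
  ∀ w → w ∈Π Π ⊎ reverse w ∈Π Π
meets-every-reversal-pair {Π} m₁ m₂ m₃ = go
  where
  hit : ∀ w → Meets Π (λ u → u ≡ w ⊎ u ≡ reverse w) → w ∈Π Π ⊎ reverse w ∈Π Π
  hit w (_ , u∈Π , inj₁ refl) = inj₁ u∈Π
  hit w (_ , u∈Π , inj₂ refl) = inj₂ u∈Π

  go : ∀ w → w ∈Π Π ⊎ reverse w ∈Π Π
  go s123 = hit s123 m₂
  go s321 = swap (hit s123 m₂)
  go s132 = hit s132 m₃
  go s231 = swap (hit s132 m₃)
  go s213 = hit s213 m₁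
  go s312 = swap (hit s213 m₁)

covered-with-reverse : (Π : SubS₃) → (∀ w → w ∈Π Π ⊎ reverse w ∈Π Π) →
  (φ : Ordering n) → Covers Π (φ ∷ reversed φ ∷ [])
covered-with-reverse Π pairs φ x with pattern-exists φ x
... | w , o with pairs w
...   | inj₁ w∈Π  = here (w , w∈Π , o)
...   | inj₂ w′∈Π = there (here (reverse w , w′∈Π , reversed-pattern))
  where
  reversed-pattern : OrdIs (reversed φ) x (reverse w)
  reversed-pattern = sorted-reverse (Bijection.to φ ∘ component x) opposite opposite-reverses w o

module Realisation {m : ℕ} (φ : Ordering (3 + m)) where

  preimage : Fin (3 + m) → Fin (3 + m)
  preimage y = proj₁ (Bijection.strictlySurjective φ y)

  φ-preimage : ∀ y → Bijection.to φ (preimage y) ≡ y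
  φ-preimage y = proj₂ (Bijection.strictlySurjective φ y)

  preimage-injective : ∀ {y z} → preimage y ≡ preimage z → y ≡ z
  preimage-injective {y} {z} e =
    trans (sym (φ-preimage y)) (trans (cong (Bijection.to φ) e) (φ-preimage z))

  sentTo : (i j k : Fin (3 + m)) → i ≢ j → i ≢ k → j ≢ k → Constraint (3 + m)
  sentTo i j k i≢j i≢k j≢k = ⟨ preimage i , preimage j , preimage k ⟩
    (i≢j ∘ preimage-injective) (i≢k ∘ preimage-injective) (j≢k ∘ preimage-injective)

  -- The constraint realising w: the a-th letter of w is sent to position a - 1
  -- (positions counted from 0).
  realise : S₃ → Constraint (3 + m)
  realise s123 = sentTo (# 0) (# 1) (# 2) (λ ()) (λ ()) (λ ())
  realise s132 = sentTo (# 0) (# 2) (# 1) (λ ()) (λ ()) (λ ())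
  realise s213 = sentTo (# 1) (# 0) (# 2) (λ ()) (λ ()) (λ ())
  realise s231 = sentTo (# 2) (# 0) (# 1) (λ ()) (λ ()) (λ ())
  realise s312 = sentTo (# 1) (# 2) (# 0) (λ ()) (λ ()) (λ ())
  realise s321 = sentTo (# 2) (# 1) (# 0) (λ ()) (λ ()) (λ ())

  increasing : Bijection.to φ (preimage (# 0)) <ᶠ Bijection.to φ (preimage (# 1)) ×
               Bijection.to φ (preimage (# 1)) <ᶠ Bijection.to φ (preimage (# 2))
  increasing = subst₂ _<ᶠ_ (sym (φ-preimage _)) (sym (φ-preimage _)) z<s
             , subst₂ _<ᶠ_ (sym (φ-preimage _)) (sym (φ-preimage _)) (s<s z<s)

  realise-sorted : ∀ w → OrdIs φ (realise w) w
  realise-sorted s123 = increasing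
  realise-sorted s132 = increasing
  realise-sorted s213 = increasing
  realise-sorted s231 = increasing
  realise-sorted s312 = increasing
  realise-sorted s321 = increasing

  -- A single ordering never covers: it realises a word w ∉ Π on some
  -- constraint, and by uniqueness no other word there.
  single-fails : (Π : SubS₃) → IsProper Π → ¬ Covers Π (φ ∷ [])
  single-fails Π (w , w∉Π) covers with covers (realise w)
  ... | here (w′ , w′∈Π , o) = true≢false (trans (sym w′∈Π) (trans (cong Π w′≡w) w∉Π))
    where
    w′≡w : w′ ≡ w
    w′≡w = sorted-unique (Bijection.to φ ∘ component (realise w)) o (realise-sorted w)

    true≢false : true ≢ false
    true≢false ()

at-least-two : ∀ {m} (Π : SubS₃) → IsProper Π →
  (Φ : List (Ordering (3 + m))) → Covers Π Φ → 2 ≤ length Φ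
at-least-two Π proper [] covers with covers (Realisation.realise (⤖-id _) s123)
... | ()
at-least-two Π proper (φ ∷ []) covers = ⊥-elim (Realisation.single-fails φ Π proper covers)
at-least-two Π proper (_ ∷ _ ∷ _) _ = s≤s (s≤s z≤n)

lemma4p5 : (Π : SubS₃) → IsProper Π → Meets Π M₁ → Meets Π M₂ → Meets Π M₃ →
    (n : ℕ) → 3 ≤ n → pIs Π n 2
lemma4p5 Π proper m₁ m₂ m₃ (suc (suc (suc m))) (s≤s (s≤s (s≤s z≤n))) =
  ( identity ∷ reversed identity ∷ [] , refl
  , covered-with-reverse Π (meets-every-reversal-pair m₁ m₂ m₃) identity )
  , at-least-two Π proper
  where
  identity : Ordering (3 + m)
  identity = ⤖-id _
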